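{- For every program $P$, every position $p$ of $P$ is reachable, i.e. there is a finite sequence of reductions $P\vdash \bot=p_0\to p_1\to\cdots\to p_k=p$ with $k\geq 0$.
   Context: Fix a set $\mathcal A$ of actions. Programs are generated by $P,Q::=A\mid P;Q\mid P^{*}\mid P+Q\mid P\parallel Q$ with $A\in\mathcal A$. Pre-positions are generated by $p,q::=\bot\mid\top\mid p;q\mid p^{(n)}\mid p+q\mid p\parallel q$ with $n\in\mathbb N$. Validity $P\vdash p$ ("$p$ is a position of $P$") is defined inductively: $P\vdash\bot$ and $P\vdash\top$ for all $P$; if $P\vdash p$ then $P;Q\vdash p;\bot$, $P+Q\vdash p+\bot$, and $P^*\vdash p^{(n)}$ for all $n$; if $Q\vdash q$ then $P;Q\vdash\top;q$ and $P+Q\vdash\bot+q$; if $P\vdash p$ and $Q\vdash q$ then $P\parallel Q\vdash p\parallel q$. The reduction relation $P\vdash p\to p'$ is defined inductively by: $A\vdash\bot\to\top$; $P;Q\vdash\bot\to\bot;\bot$; $P+Q\vdash\bot\to\bot+\bot$; $P^*\vdash\bot\to\bot^{(0)}$; $P\parallel Q\vdash\bot\to\bot\parallel\bot$; if $P\vdash p\to p'$ then $P;Q\vdash p;\bot\to p';\bot$, $P+Q\vdash p+\bot\to p'+\bot$, $P^*\vdash p^{(n)}\to p'^{(n)}$, and $P\parallel Q\vdash p\parallel q\to p'\parallel q$ for every $q$ with $Q\vdash q$; if $Q\vdash q\to q'$ then $P;Q\vdash\top;q\to\top;q'$, $P+Q\vdash\bot+q\to\bot+q'$, and $P\parallel Q\vdash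 p\parallel q\to p\parallel q'$ for every $p$ with $P\vdash p$; $P^*\vdash\top^{(n)}\to\bot^{(n+1)}$; $P;Q\vdash\top;\top\to\top$; $P+Q\vdash\top+\bot\to\top$; $P+Q\vdash\bot+\top\to\top$; $P^*\vdash\top^{(n)}\to\top$; $P\parallel Q\vdash\top\parallel\top\to\top$; $P^*\vdash\bot\to\top$ (for all $n\in\mathbb N$). -}

module Defs where

open import Data.Nat using (ℕ; suc)
open import Relation.Binary.Construct.Closure.ReflexiveTransitive using (Star)

data Prog (Act : Set) : Set where
  act  : Act → Prog Act
  _⨾_  : Prog Act → Prog Act → Prog Act
  _*   : Prog Act → Prog Act
  _⊕_  : Prog Act → Prog Act → Prog Act
  _∥_  : Prog Act → Prog Act → Prog Act

data PrePos : Set where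
  ⊥ₚ ⊤ₚ : PrePos
  _⨾ₚ_  : PrePos → PrePos → PrePos
  _^ₚ_  : PrePos → ℕ → PrePos
  _⊕ₚ_  : PrePos → PrePos → PrePos
  _∥ₚ_  : PrePos → PrePos → PrePos

module _ {Act : Set} where

  data _⊢_ : Prog Act → PrePos → Set where
    v⊥   : ∀ {P} → P ⊢ ⊥ₚ
    v⊤   : ∀ {P} → P ⊢ ⊤ₚ
    v⨾ˡ  : ∀ {P Q p} → P ⊢ p → (P ⨾ Q) ⊢ (p ⨾ₚ ⊥ₚ)
    v⊕ˡ  : ∀ {P Q p} → P ⊢ p → (P ⊕ Q) ⊢ (p ⊕ₚ ⊥ₚ)
    v*   : ∀ {P p} (n : ℕ) → P ⊢ p → (P *) ⊢ (p ^ₚ n)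
    v⨾ʳ  : ∀ {P Q q} → Q ⊢ q → (P ⨾ Q) ⊢ (⊤ₚ ⨾ₚ q)
    v⊕ʳ  : ∀ {P Q q} → Q ⊢ q → (P ⊕ Q) ⊢ (⊥ₚ ⊕ₚ q)
    v∥   : ∀ {P Q p q} → P ⊢ p → Q ⊢ q → (P ∥ Q) ⊢ (p ∥ₚ q)

  data _⊢_⟶_ : Prog Act → PrePos → PrePos → Set where
    r-act   : ∀ {A} → act A ⊢ ⊥ₚ ⟶ ⊤ₚ
    r-⨾     : ∀ {P Q} → (P ⨾ Q) ⊢ ⊥ₚ ⟶ (⊥ₚ ⨾ₚ ⊥ₚ)
    r-⊕     : ∀ {P Q} → (P ⊕ Q) ⊢ ⊥ₚ ⟶ (⊥ₚ ⊕ₚ ⊥ₚ)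
    r-*     : ∀ {P} → (P *) ⊢ ⊥ₚ ⟶ (⊥ₚ ^ₚ 0)
    r-∥     : ∀ {P Q} → (P ∥ Q) ⊢ ⊥ₚ ⟶ (⊥ₚ ∥ₚ ⊥ₚ)
    r-⨾ˡ    : ∀ {P Q p p'} → P ⊢ p ⟶ p' → (P ⨾ Q) ⊢ (p ⨾ₚ ⊥ₚ) ⟶ (p' ⨾ₚ ⊥ₚ)
    r-⊕ˡ    : ∀ {P Q p p'} → P ⊢ p ⟶ p' → (P ⊕ Q) ⊢ (p ⊕ₚ ⊥ₚ) ⟶ (p' ⊕ₚ ⊥ₚ)
    r-*in   : ∀ {P p p'} (n : ℕ) → P ⊢ p ⟶ p' → (P *) ⊢ (p ^ₚ n) ⟶ (p' ^ₚ n)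
    r-∥ˡ    : ∀ {P Q p p' q} → P ⊢ p ⟶ p' → Q ⊢ q → (P ∥ Q) ⊢ (p ∥ₚ q) ⟶ (p' ∥ₚ q)
    r-⨾ʳ    : ∀ {P Q q q'} → Q ⊢ q ⟶ q' → (P ⨾ Q) ⊢ (⊤ₚ ⨾ₚ q) ⟶ (⊤ₚ ⨾ₚ q')
    r-⊕ʳ    : ∀ {P Q q q'} → Q ⊢ q ⟶ q' → (P ⊕ Q) ⊢ (⊥ₚ ⊕ₚ q) ⟶ (⊥ₚ ⊕ₚ q')
    r-∥ʳ    : ∀ {P Q p q q'} → Q ⊢ q ⟶ q' → P ⊢ p → (P ∥ Q) ⊢ (p ∥ₚ q) ⟶ (p ∥ₚ q')
    r-*loop : ∀ {P} (n : ℕ) → (P *) ⊢ (⊤ₚ ^ₚ n) ⟶ (⊥ₚ ^ₚ suc n)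
    r-⨾end  : ∀ {P Q} → (P ⨾ Q) ⊢ (⊤ₚ ⨾ₚ ⊤ₚ) ⟶ ⊤ₚ
    r-⊕endˡ : ∀ {P Q} → (P ⊕ Q) ⊢ (⊤ₚ ⊕ₚ ⊥ₚ) ⟶ ⊤ₚ
    r-⊕endʳ : ∀ {P Q} → (P ⊕ Q) ⊢ (⊥ₚ ⊕ₚ ⊤ₚ) ⟶ ⊤ₚ
    r-*end  : ∀ {P} (n : ℕ) → (P *) ⊢ (⊤ₚ ^ₚ n) ⟶ ⊤ₚ
    r-∥end  : ∀ {P Q} → (P ∥ Q) ⊢ (⊤ₚ ∥ₚ ⊤ₚ) ⟶ ⊤ₚ
    r-*skip : ∀ {P} → (P *) ⊢ ⊥ₚ ⟶ ⊤ₚ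

  _⊢_⟶*_ : Prog Act → PrePos → PrePos → Set
  P ⊢ p ⟶* p' = Star (P ⊢_⟶_) p p'

  Reachable : Prog Act → PrePos → Set
  Reachable P p = P ⊢ ⊥ₚ ⟶* p

module Submission where

-- Every reduction rule that descends into a component is a congruence, so a run of a
-- component lifts to a run of the compound program.  Hence ⊤ is reachable in every
-- program (run each component to ⊤ in turn, then close it), the n-th iteration ⊥ ^ n
-- of a loop is reachable (run the body to ⊤, then loop, n times), and any position is
-- reached by entering its construct and lifting runs of the components, the right
-- component of a sequence only after the left one has been run to ⊤.

open import Defs
open import Data.Nat using (ℕ; zero; suc)
open import Relation.Binary.Construct.Closure.ReflexiveTransitive
  using (ε; _◅_; _◅◅_; gmap; return)

module _ {Act : Set} {P : Prog Act} {p p' : PrePos} where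

  ^-⟶* : (n : ℕ) → P ⊢ p ⟶* p' → (P *) ⊢ (p ^ₚ n) ⟶* (p' ^ₚ n)
  ^-⟶* n = gmap (_^ₚ n) (r-*in n)

module _ {Act : Set} {P Q : Prog Act} {p p' : PrePos} where

  ⨾ˡ-⟶* : P ⊢ p ⟶* p' → (P ⨾ Q) ⊢ (p ⨾ₚ ⊥ₚ) ⟶* (p' ⨾ₚ ⊥ₚ)
  ⨾ˡ-⟶* = gmap (_⨾ₚ ⊥ₚ) r-⨾ˡ

  ⨾ʳ-⟶* : Q ⊢ p ⟶* p' → (P ⨾ Q) ⊢ (⊤ₚ ⨾ₚ p) ⟶* (⊤ₚ ⨾ₚ p')
  ⨾ʳ-⟶* = gmap (⊤ₚ ⨾ₚ_) r-⨾ʳ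

  ⊕ˡ-⟶* : P ⊢ p ⟶* p' → (P ⊕ Q) ⊢ (p ⊕ₚ ⊥ₚ) ⟶* (p' ⊕ₚ ⊥ₚ)
  ⊕ˡ-⟶* = gmap (_⊕ₚ ⊥ₚ) r-⊕ˡ

  ⊕ʳ-⟶* : Q ⊢ p ⟶* p' → (P ⊕ Q) ⊢ (⊥ₚ ⊕ₚ p) ⟶* (⊥ₚ ⊕ₚ p')
  ⊕ʳ-⟶* = gmap (⊥ₚ ⊕ₚ_) r-⊕ʳ

  ∥ˡ-⟶* : ∀ {q} → Q ⊢ q → P ⊢ p ⟶* p' → (P ∥ Q) ⊢ (p ∥ₚ q) ⟶* (p' ∥ₚ q)
  ∥ˡ-⟶* {q} ⊢q = gmap (_∥ₚ q) (λ r → r-∥ˡ r ⊢q)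

  ∥ʳ-⟶* : ∀ {q} → P ⊢ q → Q ⊢ p ⟶* p' → (P ∥ Q) ⊢ (q ∥ₚ p) ⟶* (q ∥ₚ p')
  ∥ʳ-⟶* {q} ⊢q = gmap (q ∥ₚ_) (λ r → r-∥ʳ r ⊢q)


module _ {Act : Set} where

  ⊤-reachable : (P : Prog Act) → Reachable P ⊤ₚ
  ⊤-reachable (act A) = return r-act
  ⊤-reachable (P ⨾ Q) =
    r-⨾ ◅ ⨾ˡ-⟶* (⊤-reachable P) ◅◅ ⨾ʳ-⟶* (⊤-reachable Q) ◅◅ return r-⨾end
  ⊤-reachable (P *) = return r-*skip
  ⊤-reachable (P ⊕ Q) = r-⊕ ◅ ⊕ˡ-⟶* (⊤-reachable P) ◅◅ return r-⊕endˡ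
  ⊤-reachable (P ∥ Q) =
    r-∥ ◅ ∥ˡ-⟶* v⊥ (⊤-reachable P) ◅◅ ∥ʳ-⟶* v⊤ (⊤-reachable Q) ◅◅ return r-∥end

  iteration-reachable : (P : Prog Act) (n : ℕ) → Reachable (P *) (⊥ₚ ^ₚ n)
  iteration-reachable P zero = return r-*
  iteration-reachable P (suc n) =
    iteration-reachable P n ◅◅ ^-⟶* n (⊤-reachable P) ◅◅ return (r-*loop n)

  lemma2p6 : (P : Prog Act) (p : PrePos) → P ⊢ p → P ⊢ ⊥ₚ ⟶* p
  lemma2p6 P .⊥ₚ v⊥ = ε
  lemma2p6 P .⊤ₚ v⊤ = ⊤-reachable P
  lemma2p6 (P ⨾ Q) _ (v⨾ˡ {p = p} ⊢p) = r-⨾ ◅ ⨾ˡ-⟶* (lemma2p6 P p ⊢p)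
  lemma2p6 (P ⨾ Q) _ (v⨾ʳ {q = q} ⊢q) =
    r-⨾ ◅ ⨾ˡ-⟶* (⊤-reachable P) ◅◅ ⨾ʳ-⟶* (lemma2p6 Q q ⊢q)
  lemma2p6 (P ⊕ Q) _ (v⊕ˡ {p = p} ⊢p) = r-⊕ ◅ ⊕ˡ-⟶* (lemma2p6 P p ⊢p)
  lemma2p6 (P ⊕ Q) _ (v⊕ʳ {q = q} ⊢q) = r-⊕ ◅ ⊕ʳ-⟶* (lemma2p6 Q q ⊢q)
  lemma2p6 (P *) _ (v* {p = p} n ⊢p) =
    iteration-reachable P n ◅◅ ^-⟶* n (lemma2p6 P p ⊢p)
  lemma2p6 (P ∥ Q) _ (v∥ {p = p} {q = q} ⊢p ⊢q) =
    r-∥ ◅ ∥ˡ-⟶* v⊥ (lemma2p6 P p ⊢p) ◅◅ ∥ʳ-⟶* ⊢p (lemma2p6 Q q ⊢q)
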